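{- Let $T$ be a tree of order $n\ge 1$. Then $\tau(T)\le g(n)$, where $g(n)$ is the least nonnegative integer $d$ such that $2^d+d\ge n$. Moreover, this bound is sharp: for every $n\ge1$ there is a tree of order $n$ (namely the star $K_{1,n-1}$) with threshold dimension equal to $g(n)$.
   Context: A set $W$ of vertices of a connected graph is a resolving set if for every pair of distinct vertices $u,v$ there is $w\in W$ with $d(u,w)\neq d(v,w)$, where $d$ is the graph distance; the metric dimension $\beta(H)$ is the minimum size of a resolving set of $H$. The threshold dimension of a connected graph $G$ is $\tau(G)=\min\{\beta(H): H \text{ contains } G \text{ as a spanning subgraph}\}$. -}

module Defs where

open import Data.Nat using (ℕ; zero; suc; _+_; _^_; _≤_; _<_)
open import Data.Fin using (Fin; zero; suc; inject₁; fromℕ)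
open import Data.Fin.Subset using (Subset; _∈_; ∣_∣)
open import Data.Bool using (Bool; true; false)
open import Data.Product using (Σ; ∃; ∃-syntax; _×_)
open import Relation.Binary.PropositionalEquality using (_≡_; _≢_)
open import Relation.Nullary using (¬_)
open import Function.Definitions using (Injective)

record Graph (n : ℕ) : Set where
  field
    adj   : Fin n → Fin n → Bool
    sym   : ∀ u v → adj u v ≡ adj v u
    irrefl : ∀ u → adj u u ≡ false

open Graph public

Edge : ∀ {n} → Graph n → Fin n → Fin n → Set
Edge G u v = adj G u v ≡ true

data Walk {n : ℕ} (G : Graph n) : Fin n → Fin n → ℕ → Set where
  nil  : ∀ {u} → Walk G u u 0
  cons : ∀ {u v w k} → Edge G u v → Walk G v w k → Walk G u w (suc k)

Connected : ∀ {n} → Graph n → Set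
Connected G = ∀ u v → ∃[ k ] Walk G u v k

Dist : ∀ {n} → Graph n → Fin n → Fin n → ℕ → Set
Dist G u v k = Walk G u v k × (∀ j → Walk G u v j → k ≤ j)

Cycle : ∀ {n} → Graph n → Set
Cycle {n} G = ∃[ m ] Σ (Fin (suc (suc (suc m))) → Fin n) λ f →
  Injective _≡_ _≡_ f
  × (∀ (i : Fin (suc (suc m))) → Edge G (f (inject₁ i)) (f (suc i)))
  × Edge G (f (fromℕ (suc (suc m)))) (f zero)

IsTree : ∀ {n} → Graph n → Set
IsTree G = Connected G × ¬ Cycle G

Resolving : ∀ {n} → Graph n → Subset n → Set
Resolving H W = ∀ u v → u ≢ v →
  ∃[ w ] (w ∈ W × ∃[ k₁ ] ∃[ k₂ ] (Dist H u w k₁ × Dist H v w k₂ × k₁ ≢ k₂))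

IsMetricDim : ∀ {n} → Graph n → ℕ → Set
IsMetricDim H b = (∃[ W ] (Resolving H W × ∣ W ∣ ≡ b))
                × (∀ W → Resolving H W → b ≤ ∣ W ∣)

SpanningSuper : ∀ {n} → Graph n → Graph n → Set
SpanningSuper G H = ∀ u v → Edge G u v → Edge H u v

IsThresholdDim : ∀ {n} → Graph n → ℕ → Set
IsThresholdDim G t =
    (∃[ H ] (SpanningSuper G H × IsMetricDim H t))
  × (∀ H b → SpanningSuper G H → IsMetricDim H b → t ≤ b)

IsG : ℕ → ℕ → Set
IsG n d = n ≤ 2 ^ d + d × (∀ e → e < d → ¬ (n ≤ 2 ^ e + e))

-- The star K_{1,m} on Fin (suc m) with centre zero (order m+1).
starAdj : ∀ {m} → Fin (suc m) → Fin (suc m) → Bool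
starAdj zero    zero    = false
starAdj zero    (suc _) = true
starAdj (suc _) zero    = true
starAdj (suc _) (suc _) = false

starSym : ∀ {m} (u v : Fin (suc m)) → starAdj u v ≡ starAdj v u
starSym zero    zero    = _≡_.refl
starSym zero    (suc _) = _≡_.refl
starSym (suc _) zero    = _≡_.refl
starSym (suc _) (suc _) = _≡_.refl

starIrr : ∀ {m} (u : Fin (suc m)) → starAdj u u ≡ false
starIrr zero    = _≡_.refl
starIrr (suc _) = _≡_.refl

star : (m : ℕ) → Graph (suc m)
star m = record { adj = starAdj ; sym = starSym ; irrefl = starIrr }

-- Peeling leaves off a forest of order n gives, for every d < n, a set W of d vertices each
-- having at most one neighbour outside W, so the sets of W-neighbours of the vertices outside W
-- are pairwise disjoint. Give every vertex outside W a distinct d-bit code: its set of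
-- W-neighbours when that is nonempty, the full code for one vertex c, anything otherwise;
-- 2^d codes suffice when n ≤ 2^d + d. Joining every vertex outside W to the members of W in its
-- code and making c universal gives a supergraph in which all distances are 1 or 2, so the
-- distances to W recover the codes and W is resolving.
-- Conversely, the centre of the star is universal in every spanning supergraph, and in a graph
-- with a universal vertex a resolving set W separates the n − |W| vertices outside it by their
-- adjacency to W, whence n ≤ 2^|W| + |W|.

module Submission where

open import Defs
open import Data.Bool as Bool using (Bool; true; false)
open import Data.Empty using (⊥; ⊥-elim)
open import Data.Fin using (Fin; zero; suc; toℕ; inject₁; inject≤; fromℕ; funToFin; finToFun; combine)
open import Data.Fin.Permutation.Components using (transpose; transpose-inverse)
open import Data.Fin.Properties
  using ( _≟_; any?; all?; ¬∀⟶∃¬; suc-injective; injective⇒≤; inject≤-injective; 2↔Bool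
        ; toℕ-injective; toℕ<n; toℕ-inject₁; toℕ-inject≤; toℕ-fromℕ; funToFin-finToFin; finToFun-funToFin)
open import Data.Fin.Subset using (Subset; _∈_; _∉_; _⊆_; ∣_∣; ∁; ⁅_⁆; _∪_; Nonempty)
import Data.Fin.Subset as Subset
open import Data.Fin.Subset.Properties
  using ( _∈?_; ∉⊥; ∣⊥∣≡0; ∪-identityʳ; p⊆p∪q; x∈p∪q⁻; x∈⁅y⁆⇒x≡y; x∈∁p⇒x∉p; x∉p⇒x∈∁p
        ; ∣∁p∣≡n∸∣p∣; ∣p∣≤n)
open import Data.List using (List; []; _∷_; allFin)
open import Data.List.Relation.Unary.All using (All; []; _∷_)
import Data.List.Relation.Unary.All as All
open import Data.List.Relation.Unary.All.Properties using (tabulate⁻)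
open import Data.Maybe using (Maybe; just; nothing)
open import Data.Maybe.Properties using (just-injective)
open import Data.Nat using (ℕ; zero; suc; _+_; _^_; _≤_; _<_; _≤?_; z≤n; s≤s)
open import Data.Nat.Induction using (<-rec)
open import Data.Nat.Properties
  using ( ≤-antisym; ≤-trans; <⇒≤; ≮⇒≥; 1+n≰n; m^n>0; m<n⇒0<n∸m; +-comm; +-monoˡ-≤; m∸n+n≡m
        ; m≤n+o⇒m∸n≤o)
open import Data.Product using (∃; ∃-syntax; _×_; _,_; proj₁; proj₂)
import Data.Product as Product
open import Data.Sum using (_⊎_; inj₁; inj₂)
import Data.Sum as Sum
open import Data.Vec using ([]; _∷_; here; there)
open import Function using (_∘_; Injective; _⇔_; mk⇔; Inverse; Equivalence)
open import Relation.Binary.PropositionalEquality as ≡ using (_≡_; _≢_; refl; trans; cong; subst)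
open import Relation.Nullary using (¬_; Dec; yes; no; does; contradiction)
open import Relation.Nullary.Decidable
  using (dec-true; dec-false; does-⇔; decidable-stable; ¬?; _×-dec_; _⊎-dec_; _→-dec_)

edge-sym : ∀ {n} (G : Graph n) {u v} → Edge G u v → Edge G v u
edge-sym G {u} {v} e = trans (sym G v u) e

edge⇒≢ : ∀ {n} (G : Graph n) {u v} → Edge G u v → u ≢ v
edge⇒≢ G {u} e refl with trans (≡.sym e) (irrefl G u)
... | ()

does≡b : ∀ {A : Set} {b} (a? : Dec A) → (A → b ≡ true) → (b ≡ true → A) → does a? ≡ b
does≡b {b = true}  (yes _)  _ _ = refl
does≡b {b = false} (yes a)  f _ = ≡.sym (f a)
does≡b {b = true}  (no ¬a)  _ g = contradiction (g refl) ¬a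
does≡b {b = false} (no _)   _ _ = refl

module RelationGraph {n} (R : Fin n → Fin n → Set) (R? : ∀ u v → Dec (R u v))
                     (R-sym : ∀ {u v} → R u v → R v u) (R-irrefl : ∀ u → ¬ R u u) where

  graph : Graph n
  graph = record
    { adj    = λ u v → does (R? u v)
    ; sym    = λ u v → does-⇔ (mk⇔ R-sym R-sym) (R? u v) (R? v u)
    ; irrefl = λ u → dec-false (R? u u) (R-irrefl u)
    }

  edge⁺ : ∀ {u v} → R u v → Edge graph u v
  edge⁺ {u} {v} = dec-true (R? u v)

  adj-≡ : ∀ {u v b} → (R u v → b ≡ true) → (b ≡ true → R u v) → adj graph u v ≡ b
  adj-≡ {u} {v} = does≡b (R? u v)

-- Distances in graphs with a universal vertex

Universal : ∀ {n} → Graph n → Fin n → Set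
Universal G c = ∀ x → x ≢ c → Edge G c x

walk₀⇒≡ : ∀ {n} {G : Graph n} {u v} → Walk G u v 0 → u ≡ v
walk₀⇒≡ nil = refl

Dist-unique : ∀ {n} {G : Graph n} {u v k l} → Dist G u v k → Dist G u v l → k ≡ l
Dist-unique (p , p-min) (q , q-min) = ≤-antisym (p-min _ q) (q-min _ p)

Dist-refl : ∀ {n} {G : Graph n} u → Dist G u u 0
Dist-refl u = nil , λ _ _ → z≤n

Dist-edge : ∀ {n} (G : Graph n) {u v} → Edge G u v → Dist G u v 1
Dist-edge G e = cons e nil , at-least-one
  where
  at-least-one : ∀ j → Walk G _ _ j → 1 ≤ j
  at-least-one zero    w = contradiction (walk₀⇒≡ w) (edge⇒≢ G e)
  at-least-one (suc j) _ = s≤s z≤n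

Dist-nonadjacent : ∀ {n} (G : Graph n) {c} → Universal G c →
                   ∀ {u v} → u ≢ v → adj G u v ≡ false → Dist G u v 2
Dist-nonadjacent G {c} universal {u} {v} u≢v nonadjacent =
  cons (edge-sym G (universal u u≢c)) (cons (universal v v≢c) nil) , at-least-two
  where
  u≢c : u ≢ c
  u≢c refl with trans (≡.sym nonadjacent) (universal v (u≢v ∘ ≡.sym))
  ... | ()
  v≢c : v ≢ c
  v≢c refl with trans (≡.sym nonadjacent) (edge-sym G (universal u u≢v))
  ... | ()
  at-least-two : ∀ j → Walk G u v j → 2 ≤ j
  at-least-two zero w = contradiction (walk₀⇒≡ w) u≢v
  at-least-two (suc zero) (cons e w) with walk₀⇒≡ w
  ... | refl with trans (≡.sym nonadjacent) e
  ... | ()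
  at-least-two (suc (suc j)) _ = s≤s (s≤s z≤n)

hubDist : Bool → ℕ
hubDist true  = 1
hubDist false = 2

hubDist-injective : ∀ {a b} → hubDist a ≡ hubDist b → a ≡ b
hubDist-injective {false} {false} _ = refl
hubDist-injective {true}  {true}  _ = refl

0≢hubDist : ∀ b → 0 ≢ hubDist b
0≢hubDist true  ()
0≢hubDist false ()

Universal⇒Dist : ∀ {n} (G : Graph n) {c} → Universal G c →
                 ∀ {u v} → u ≢ v → Dist G u v (hubDist (adj G u v))
Universal⇒Dist G universal {u} {v} u≢v with adj G u v in e
... | true  = Dist-edge G e
... | false = Dist-nonadjacent G universal u≢v e

enum : ∀ {n} (p : Subset n) → Fin ∣ p ∣ → Fin n
enum (true  ∷ p) zero    = zero
enum (true  ∷ p) (suc i) = suc (enum p i)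
enum (false ∷ p) i       = suc (enum p i)

enum-∈ : ∀ {n} (p : Subset n) i → enum p i ∈ p
enum-∈ (true  ∷ p) zero    = here
enum-∈ (true  ∷ p) (suc i) = there (enum-∈ p i)
enum-∈ (false ∷ p) i       = there (enum-∈ p i)

enum-injective : ∀ {n} (p : Subset n) → Injective _≡_ _≡_ (enum p)
enum-injective (true  ∷ p) {zero}  {zero}  _ = refl
enum-injective (true  ∷ p) {suc i} {suc j} e = cong suc (enum-injective p (suc-injective e))
enum-injective (false ∷ p) e = enum-injective p (suc-injective e)

enum-surjective : ∀ {n} (p : Subset n) {x} → x ∈ p → ∃[ i ] enum p i ≡ x
enum-surjective (true  ∷ p) here = zero , refl
enum-surjective (true  ∷ p) (there x∈p) with enum-surjective p x∈p
... | i , refl = suc i , refl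
enum-surjective (false ∷ p) (there x∈p) with enum-surjective p x∈p
... | i , refl = i , refl

∉⇒≢ : ∀ {n} {p : Subset n} {u w} → u ∉ p → w ∈ p → u ≢ w
∉⇒≢ u∉p w∈p refl = u∉p w∈p

encode : ∀ {k} → (Fin k → Bool) → Fin (2 ^ k)
encode f = funToFin (Inverse.from 2↔Bool ∘ f)

decode : ∀ {k} → Fin (2 ^ k) → Fin k → Bool
decode {k} a j = Inverse.to 2↔Bool (finToFun {2} {k} a j)

decode-encode : ∀ {k} (f : Fin k → Bool) j → decode (encode f) j ≡ f j
decode-encode f j = trans (cong (Inverse.to 2↔Bool) (finToFun-funToFin (Inverse.from 2↔Bool ∘ f) j))
                          (Inverse.strictlyInverseˡ 2↔Bool (f j))

encode-injective : ∀ {k} {f g : Fin k → Bool} → encode f ≡ encode g → ∀ j → f j ≡ g j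
encode-injective {f = f} {g} same j =
  trans (≡.sym (decode-encode f j)) (trans (cong (λ a → decode a j) same) (decode-encode g j))

funToFin-cong : ∀ {m k} {f g : Fin m → Fin k} → (∀ i → f i ≡ g i) → funToFin f ≡ funToFin g
funToFin-cong {zero}  _   = refl
funToFin-cong {suc m} f≗g = ≡.cong₂ combine (f≗g zero) (funToFin-cong (f≗g ∘ suc))

decode-injective : ∀ {k} {a b : Fin (2 ^ k)} → (∀ j → decode a j ≡ decode b j) → a ≡ b
decode-injective {k} {a} {b} same = begin
  a                   ≡⟨ funToFin-finToFin {k} {2} a ⟨
  funToFin (digits a) ≡⟨ funToFin-cong same-digits ⟩
  funToFin (digits b) ≡⟨ funToFin-finToFin {k} {2} b ⟩
  b                   ∎
  where
  open ≡.≡-Reasoning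
  digits : Fin (2 ^ k) → Fin k → Fin 2
  digits = finToFun {2} {k}
  from-to : ∀ x → Inverse.from 2↔Bool (Inverse.to 2↔Bool x) ≡ x
  from-to = Inverse.strictlyInverseʳ 2↔Bool
  same-digits : ∀ j → digits a j ≡ digits b j
  same-digits j = trans (≡.sym (from-to _)) (trans (cong (Inverse.from 2↔Bool) (same j)) (from-to _))

∣∁p∣≤m⇔n≤m+∣p∣ : ∀ {n} (p : Subset n) m → ∣ ∁ p ∣ ≤ m ⇔ n ≤ m + ∣ p ∣
∣∁p∣≤m⇔n≤m+∣p∣ {n} p m = mk⇔ to from
  where
  to : ∣ ∁ p ∣ ≤ m → n ≤ m + ∣ p ∣
  to h = subst (_≤ m + ∣ p ∣) (m∸n+n≡m (∣p∣≤n p))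
               (+-monoˡ-≤ ∣ p ∣ (subst (_≤ m) (∣∁p∣≡n∸∣p∣ p) h))
  from : n ≤ m + ∣ p ∣ → ∣ ∁ p ∣ ≤ m
  from h = subst (_≤ m) (≡.sym (∣∁p∣≡n∸∣p∣ p))
                 (m≤n+o⇒m∸n≤o n ∣ p ∣ (subst (n ≤_) (+-comm m ∣ p ∣) h))

Universal-Resolving⇒∣∁W∣≤2^∣W∣ : ∀ {n} (H : Graph n) {c} → Universal H c →
                                 ∀ W → Resolving H W → ∣ ∁ W ∣ ≤ 2 ^ ∣ W ∣
Universal-Resolving⇒∣∁W∣≤2^∣W∣ {n} H universal W resolves =
  injective⇒≤ {f = code ∘ outside} code-injective
  where
  outside : Fin ∣ ∁ W ∣ → Fin n
  outside = enum (∁ W)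
  outside∉W : ∀ i → outside i ∉ W
  outside∉W i = x∈∁p⇒x∉p (enum-∈ (∁ W) i)
  code : Fin n → Fin (2 ^ ∣ W ∣)
  code u = encode (λ j → adj H u (enum W j))
  code-injective : ∀ {i i′} → code (outside i) ≡ code (outside i′) → i ≡ i′
  code-injective {i} {i′} same with outside i ≟ outside i′
  ... | yes e = enum-injective (∁ W) e
  ... | no u≢v with resolves (outside i) (outside i′) u≢v
  ... | w , w∈W , k , k′ , dist , dist′ , k≢k′ with enum-surjective W w∈W
  ... | j , refl = contradiction (begin
        k                                       ≡⟨ Dist-unique dist (dist-to-W i) ⟩
        hubDist (adj H (outside i) (enum W j))  ≡⟨ cong hubDist (encode-injective same j) ⟩
        hubDist (adj H (outside i′) (enum W j)) ≡⟨ Dist-unique (dist-to-W i′) dist′ ⟩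
        k′                                      ∎) k≢k′
    where
    open ≡.≡-Reasoning
    dist-to-W : ∀ i → Dist H (outside i) (enum W j) (hubDist (adj H (outside i) (enum W j)))
    dist-to-W i = Universal⇒Dist H universal (∉⇒≢ (outside∉W i) w∈W)

-- Extending a partial injection

transpose-injective : ∀ {M} (a b : Fin M) → Injective _≡_ _≡_ (transpose a b)
transpose-injective a b e =
  trans (≡.sym (transpose-inverse b a)) (trans (cong (transpose b a) e) (transpose-inverse b a))

transpose-matchˡ : ∀ {M} (a b : Fin M) → transpose a b a ≡ b
transpose-matchˡ a b rewrite dec-true (a ≟ a) refl = refl

transpose-fixed : ∀ {M} {a b x : Fin M} → x ≢ a → x ≢ b → transpose a b x ≡ x
transpose-fixed {a = a} {b} {x} x≢a x≢b rewrite dec-false (x ≟ a) x≢a | dec-false (x ≟ b) x≢b = refl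

PartialInjective : ∀ {k M} → (Fin k → Maybe (Fin M)) → Set
PartialInjective g = ∀ {i j y} → g i ≡ just y → g j ≡ just y → i ≡ j

Realises : ∀ {k M} → (Fin k → Maybe (Fin M)) → (Fin k → Fin M) → Fin k → Set
Realises g h i = ∀ {y} → g i ≡ just y → h i ≡ y

module _ {k M} (g : Fin k → Maybe (Fin M)) (g-injective : PartialInjective g) (k≤M : k ≤ M) where

  -- Values are fixed one point at a time by a transposition; points fixed earlier are
  -- untouched, their values differing from both transposed ones.
  realiseAll : (xs : List (Fin k)) → ∃[ h ] (Injective _≡_ _≡_ h × All (Realises g h) xs)
  realiseAll [] = (λ i → inject≤ i k≤M) , inject≤-injective k≤M k≤M _ _ , []
  realiseAll (x ∷ xs) with realiseAll xs | g x in gx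
  ... | h , h-injective , realised | nothing =
    h , h-injective , (λ gx≡just → contradiction (trans (≡.sym gx) gx≡just) λ ()) ∷ realised
  ... | h , h-injective , realised | just y =
    swap ∘ h , h-injective ∘ transpose-injective (h x) y , realises-x ∷ All.map still-realises realised
    where
    swap : Fin M → Fin M
    swap = transpose (h x) y
    realises-x : Realises g (swap ∘ h) x
    realises-x gx≡just with trans (≡.sym gx) gx≡just
    ... | refl = transpose-matchˡ (h x) y
    still-realises : ∀ {i} → Realises g h i → Realises g (swap ∘ h) i
    still-realises {i} realises-i {yᵢ} gi with i ≟ x
    ... | yes refl = realises-x gi
    ... | no i≢x = trans (cong swap (realises-i gi)) (transpose-fixed yᵢ≢hx yᵢ≢y)
      where
      yᵢ≢hx : yᵢ ≢ h x
      yᵢ≢hx yᵢ≡hx = i≢x (h-injective (trans (realises-i gi) yᵢ≡hx))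
      yᵢ≢y : yᵢ ≢ y
      yᵢ≢y refl = i≢x (g-injective gi gx)

  extendPartialInjection : ∃[ h ] (Injective _≡_ _≡_ h × ∀ i → Realises g h i)
  extendPartialInjection with realiseAll (allFin k)
  ... | h , h-injective , realised = h , h-injective , tabulate⁻ realised

-- A supergraph with a universal vertex resolved by a given set

Dominates : ∀ {n} → Graph n → Subset n → Fin n → Set
Dominates T W u = ∀ w → w ∈ W → Edge T u w

AtMostOneNeighbourIn : ∀ {n} → Graph n → Subset n → Fin n → Set
AtMostOneNeighbourIn T S x = ∀ {u v} → u ∈ S → v ∈ S → Edge T x u → Edge T x v → u ≡ v

AtMostOneNeighbourOutside : ∀ {n} → Graph n → Subset n → Set
AtMostOneNeighbourOutside T W = ∀ {w} → w ∈ W → AtMostOneNeighbourIn T (∁ W) w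

module UniversalSupergraph {n} (T : Graph n) (W : Subset n)
  (pendant : AtMostOneNeighbourOutside T W) (few-outside : ∣ ∁ W ∣ ≤ 2 ^ ∣ W ∣)
  (c : Fin n) (c∉W : c ∉ W)
  (undominated : ∀ {u w} → u ∉ W → u ≢ c → w ∈ W → Edge T u w → ¬ Dominates T W u)
  where

  outside : Fin ∣ ∁ W ∣ → Fin n
  outside = enum (∁ W)

  member : Fin ∣ W ∣ → Fin n
  member = enum W

  outside∉W : ∀ i → outside i ∉ W
  outside∉W i = x∈∁p⇒x∉p (enum-∈ (∁ W) i)

  trace : Fin n → Fin ∣ W ∣ → Bool
  trace u j = adj T u (member j)

  full : Fin (2 ^ ∣ W ∣)
  full = encode {∣ W ∣} (λ _ → true)

  -- The hub needs the full code and a vertex with neighbours in W must keep them.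
  data Prescription (u : Fin n) : Maybe (Fin (2 ^ ∣ W ∣)) → Set where
    hub           : u ≡ c → Prescription u (just full)
    traced        : u ≢ c → ∀ j → trace u j ≡ true → Prescription u (just (encode (trace u)))
    unconstrained : u ≢ c → (∀ j → trace u j ≢ true) → Prescription u nothing

  prescription : ∀ u → ∃ (Prescription u)
  prescription u with u ≟ c | any? (λ j → trace u j Bool.≟ true)
  ... | yes u≡c | _          = _ , hub u≡c
  ... | no u≢c  | yes (j , t) = _ , traced u≢c j t
  ... | no u≢c  | no none     = _ , unconstrained u≢c (λ j t → none (j , t))

  prescribed : Fin n → Maybe (Fin (2 ^ ∣ W ∣))
  prescribed u = proj₁ (prescription u)

  full⇒Dominates : ∀ {u} → encode (trace u) ≡ full → Dominates T W u
  full⇒Dominates {u} trace-full w w∈W with enum-surjective W w∈W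
  ... | j , refl = encode-injective trace-full j

  prescribed-injective : ∀ {u v y} → u ∉ W → v ∉ W → prescribed u ≡ just y → prescribed v ≡ just y → u ≡ v
  prescribed-injective {u} {v} u∉W v∉W pu pv with prescription u | prescription v
  ... | _ , hub u≡c | _ , hub v≡c = trans u≡c (≡.sym v≡c)
  ... | _ , hub _ | _ , traced v≢c j t =
    ⊥-elim (undominated v∉W v≢c (enum-∈ W j) t (full⇒Dominates (just-injective (trans pv (≡.sym pu)))))
  ... | _ , traced u≢c j t | _ , hub _ =
    ⊥-elim (undominated u∉W u≢c (enum-∈ W j) t (full⇒Dominates (just-injective (trans pu (≡.sym pv)))))
  ... | _ , traced _ j t | _ , traced _ _ _ =
    pendant (enum-∈ W j) (x∉p⇒x∈∁p u∉W) (x∉p⇒x∈∁p v∉W)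
            (edge-sym T t) (edge-sym T (trans (≡.sym same-trace) t))
    where
    same-trace : trace u j ≡ trace v j
    same-trace = encode-injective (just-injective (trans pu (≡.sym pv))) j
  prescribed-injective _ _ () _ | _ , unconstrained _ _ | _
  prescribed-injective _ _ _ () | _ , hub _ | _ , unconstrained _ _
  prescribed-injective _ _ _ () | _ , traced _ _ _ | _ , unconstrained _ _

  codes : ∃[ h ] (Injective _≡_ _≡_ h × ∀ i → Realises (prescribed ∘ outside) h i)
  codes = extendPartialInjection (prescribed ∘ outside)
            (λ pi pj → enum-injective (∁ W) (prescribed-injective (outside∉W _) (outside∉W _) pi pj))
            few-outside

  code : Fin ∣ ∁ W ∣ → Fin (2 ^ ∣ W ∣)
  code = proj₁ codes

  bit : Fin ∣ ∁ W ∣ → Fin ∣ W ∣ → Bool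
  bit i = decode (code i)

  bits-injective : ∀ {i i′} → (∀ j → bit i j ≡ bit i′ j) → i ≡ i′
  bits-injective same = proj₁ (proj₂ codes) (decode-injective same)

  bit-prescribed : ∀ {i f} → prescribed (outside i) ≡ just (encode f) → ∀ j → bit i j ≡ f j
  bit-prescribed {i} {f} p j = trans (cong (λ a → decode a j) (proj₂ (proj₂ codes) i p)) (decode-encode f j)

  bit-hub : ∀ i j → outside i ≡ c → bit i j ≡ true
  bit-hub i j o≡c with prescription (outside i) | bit-prescribed {i}
  ... | _ , hub _                  | decodes = decodes refl j
  ... | _ , traced o≢c _ _         | _       = contradiction o≡c o≢c
  ... | _ , unconstrained o≢c _    | _       = contradiction o≡c o≢c

  bit-edge : ∀ i j → Edge T (outside i) (member j) → bit i j ≡ true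
  bit-edge i j e with prescription (outside i) | bit-prescribed {i}
  ... | _ , hub _                  | decodes = decodes refl j
  ... | _ , traced _ _ _           | decodes = trans (decodes refl j) e
  ... | _ , unconstrained _ none   | _       = contradiction e (none j)

  Cross : Fin n → Fin n → Set
  Cross u w = ∃[ i ] ∃[ j ] (outside i ≡ u × member j ≡ w × bit i j ≡ true)

  Link : Fin n → Fin n → Set
  Link u v = Edge T u v ⊎ u ≡ c ⊎ Cross u v

  link? : ∀ u v → Dec (Link u v)
  link? u v = (adj T u v Bool.≟ true) ⊎-dec (u ≟ c) ⊎-dec
    any? (λ i → any? (λ j → (outside i ≟ u) ×-dec (member j ≟ v) ×-dec (bit i j Bool.≟ true)))

  Adjacent : Fin n → Fin n → Set
  Adjacent u v = u ≢ v × (Link u v ⊎ Link v u)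

  adjacent? : ∀ u v → Dec (Adjacent u v)
  adjacent? u v = ¬? (u ≟ v) ×-dec (link? u v ⊎-dec link? v u)

  Adjacent-sym : ∀ {u v} → Adjacent u v → Adjacent v u
  Adjacent-sym (u≢v , link) = u≢v ∘ ≡.sym , Sum.swap link

  Adjacent-irrefl : ∀ u → ¬ Adjacent u u
  Adjacent-irrefl u (u≢u , _) = u≢u refl

  open RelationGraph Adjacent adjacent? Adjacent-sym Adjacent-irrefl public renaming (graph to H)

  super : SpanningSuper T H
  super u v e = edge⁺ (edge⇒≢ T e , inj₁ (inj₁ e))

  universal : Universal H c
  universal x x≢c = edge⁺ (x≢c ∘ ≡.sym , inj₁ (inj₂ (inj₁ refl)))

  adj-bit : ∀ i j → adj H (outside i) (member j) ≡ bit i j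
  adj-bit i j = adj-≡ adjacent⇒bit
    (λ t → ∉⇒≢ (outside∉W i) (enum-∈ W j) , inj₁ (inj₂ (inj₂ (i , j , refl , refl , t))))
    where
    adjacent⇒bit : Adjacent (outside i) (member j) → bit i j ≡ true
    adjacent⇒bit (_ , inj₁ (inj₁ e))                 = bit-edge i j e
    adjacent⇒bit (_ , inj₁ (inj₂ (inj₁ o≡c)))         = bit-hub i j o≡c
    adjacent⇒bit (_ , inj₁ (inj₂ (inj₂ (i′ , j′ , o≡ , m≡ , t))))
      with enum-injective (∁ W) o≡ | enum-injective W m≡
    ... | refl | refl = t
    adjacent⇒bit (_ , inj₂ (inj₁ e))                 = bit-edge i j (edge-sym T e)
    adjacent⇒bit (_ , inj₂ (inj₂ (inj₁ m≡c)))         = contradiction (subst (_∈ W) m≡c (enum-∈ W j)) c∉W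
    adjacent⇒bit (_ , inj₂ (inj₂ (inj₂ (i′ , _ , o≡m , _ , _)))) =
      contradiction (subst (_∈ W) (≡.sym o≡m) (enum-∈ W j)) (outside∉W i′)

  resolving : Resolving H W
  resolving u v u≢v with u ∈? W | v ∈? W
  ... | yes u∈W | _ =
    u , u∈W , 0 , _ , Dist-refl u , Universal⇒Dist H universal (u≢v ∘ ≡.sym) , 0≢hubDist _
  ... | no _ | yes v∈W =
    v , v∈W , _ , 0 , Universal⇒Dist H universal u≢v , Dist-refl v , 0≢hubDist _ ∘ ≡.sym
  ... | no u∉W | no v∉W with enum-surjective (∁ W) (x∉p⇒x∈∁p u∉W) | enum-surjective (∁ W) (x∉p⇒x∈∁p v∉W)
  ... | i , refl | i′ , refl
    with ¬∀⟶∃¬ ∣ W ∣ (λ j → bit i j ≡ bit i′ j) (λ j → bit i j Bool.≟ bit i′ j)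
               (λ same → u≢v (cong outside (bits-injective same)))
  ... | j , bits-differ =
    member j , enum-∈ W j , _ , _ ,
    Universal⇒Dist H universal (∉⇒≢ u∉W (enum-∈ W j)) ,
    Universal⇒Dist H universal (∉⇒≢ v∉W (enum-∈ W j)) ,
    λ same-dist → bits-differ (trans (≡.sym (adj-bit i j)) (trans (hubDist-injective same-dist) (adj-bit i′ j)))

-- A vertex outside W dominating W, if there is one, has to be the hub; by pendancy it is unique.
hubCandidate : ∀ {n} (T : Graph n) (W : Subset n) → AtMostOneNeighbourOutside T W → Nonempty (∁ W) →
               ∃[ c ] (c ∉ W × ∀ {u w} → u ∉ W → u ≢ c → w ∈ W → Edge T u w → ¬ Dominates T W u)
hubCandidate T W pendant (x , x∈∁W)
  with any? (λ u → ¬? (u ∈? W) ×-dec all? (λ w → (w ∈? W) →-dec (adj T u w Bool.≟ true)))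
... | yes (c , c∉W , c-dominates) = c , c∉W , λ u∉W u≢c w∈W e _ →
  u≢c (pendant w∈W (x∉p⇒x∈∁p u∉W) (x∉p⇒x∈∁p c∉W) (edge-sym T e) (edge-sym T (c-dominates _ w∈W)))
... | no none = x , x∈∁p⇒x∉p x∈∁W , λ u∉W _ _ _ dominates → none (_ , u∉W , dominates)

resolvedSupergraph : ∀ {n} (T : Graph n) (W : Subset n) → AtMostOneNeighbourOutside T W →
                     ∣ ∁ W ∣ ≤ 2 ^ ∣ W ∣ → Nonempty (∁ W) →
                     ∃[ H ] (SpanningSuper T H × Resolving H W)
resolvedSupergraph T W pendant few-outside nonempty with hubCandidate T W pendant nonempty
... | c , c∉W , undominated = H , super , resolving
  where open UniversalSupergraph T W pendant few-outside c c∉W undominated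

-- Leaves and pendant sets in forests

module Paths {n} (T : Graph n) (S : Subset n) where

  record PathIn (k : ℕ) : Set where
    field
      vertex    : Fin (suc k) → Fin n
      injective : Injective _≡_ _≡_ vertex
      inside    : ∀ i → vertex i ∈ S
      step      : ∀ (i : Fin k) → Edge T (vertex (inject₁ i)) (vertex (suc i))

  open PathIn

  trivialPath : ∀ {x} → x ∈ S → PathIn 0
  trivialPath {x} x∈S = record
    { vertex    = λ _ → x
    ; injective = λ { {zero} {zero} _ → refl }
    ; inside    = λ _ → x∈S
    ; step      = λ ()
    }

  prepend : ∀ {k} (P : PathIn k) {u} → u ∈ S → Edge T (vertex P zero) u → (∀ i → vertex P i ≢ u) →
            PathIn (suc k)
  prepend {k} P {u} u∈S e fresh = record
    { vertex    = vertex′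
    ; injective = injective′
    ; inside    = λ { zero → u∈S ; (suc i) → inside P i }
    ; step      = λ { zero → edge-sym T e ; (suc i) → step P i }
    }
    where
    vertex′ : Fin (suc (suc k)) → Fin n
    vertex′ zero    = u
    vertex′ (suc i) = vertex P i
    injective′ : Injective _≡_ _≡_ vertex′
    injective′ {zero}  {zero}  _ = refl
    injective′ {zero}  {suc j} e = contradiction (≡.sym e) (fresh j)
    injective′ {suc i} {zero}  e = contradiction e (fresh i)
    injective′ {suc i} {suc j} e = cong suc (injective P e)

  truncate : ∀ {k l} → PathIn k → l ≤ k → PathIn l
  truncate P l≤k = record
    { vertex    = λ i → vertex P (inject≤ i (s≤s l≤k))
    ; injective = λ e → inject≤-injective _ _ _ _ (injective P e)
    ; inside    = λ i → inside P _
    ; step      = λ i → subst (λ x → Edge T (vertex P x) (vertex P (suc (inject≤ i l≤k))))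
                            (inject₁-inject≤ i) (step P (inject≤ i l≤k))
    }
    where
    inject₁-inject≤ : ∀ i → inject₁ (inject≤ i l≤k) ≡ inject≤ (inject₁ i) (s≤s l≤k)
    inject₁-inject≤ i = toℕ-injective (begin
      toℕ (inject₁ (inject≤ i l≤k))      ≡⟨ toℕ-inject₁ _ ⟩
      toℕ (inject≤ i l≤k)                ≡⟨ toℕ-inject≤ i l≤k ⟩
      toℕ i                              ≡⟨ toℕ-inject₁ i ⟨
      toℕ (inject₁ i)                    ≡⟨ toℕ-inject≤ (inject₁ i) (s≤s l≤k) ⟨
      toℕ (inject≤ (inject₁ i) (s≤s l≤k)) ∎)
      where open ≡.≡-Reasoning

  chord⇒Cycle : ∀ {k} (P : PathIn (suc k)) (i : Fin k) →
                Edge T (vertex P zero) (vertex P (suc (suc i))) → Cycle T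
  chord⇒Cycle P i e = toℕ i , vertex P′ , injective P′ , step P′ ,
    subst (λ x → Edge T (vertex P x) (vertex P zero)) (≡.sym last≡) (edge-sym T e)
    where
    P′ : PathIn (suc (suc (toℕ i)))
    P′ = truncate P (s≤s (toℕ<n i))
    last≡ : inject≤ (fromℕ (suc (suc (toℕ i)))) (s≤s (s≤s (toℕ<n i))) ≡ suc (suc i)
    last≡ = toℕ-injective (trans (toℕ-inject≤ (fromℕ _) (s≤s (s≤s (toℕ<n i)))) (toℕ-fromℕ _))

  onlyNeighbourOnPath : ¬ Cycle T → ∀ {k} (P : PathIn k) i j →
                        Edge T (vertex P zero) (vertex P i) → Edge T (vertex P zero) (vertex P j) →
                        vertex P i ≡ vertex P j
  onlyNeighbourOnPath _ P zero _ e _ = contradiction refl (edge⇒≢ T e)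
  onlyNeighbourOnPath _ P _ zero _ e = contradiction refl (edge⇒≢ T e)
  onlyNeighbourOnPath acyclic P (suc (suc i)) _ e _ = ⊥-elim (acyclic (chord⇒Cycle P i e))
  onlyNeighbourOnPath acyclic P _ (suc (suc j)) _ e = ⊥-elim (acyclic (chord⇒Cycle P j e))
  onlyNeighbourOnPath _ P (suc zero) (suc zero) _ _ = refl

  growOrLeaf : ¬ Cycle T → ∀ {k} (P : PathIn k) → PathIn (suc k) ⊎ AtMostOneNeighbourIn T S (vertex P zero)
  growOrLeaf acyclic P
    with any? (λ u → (u ∈? S) ×-dec (adj T (vertex P zero) u Bool.≟ true) ×-dec
                     all? (λ i → ¬? (vertex P i ≟ u)))
  ... | yes (u , u∈S , e , fresh) = inj₁ (prepend P u∈S e fresh)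
  ... | no stuck = inj₂ atMostOne
    where
    onPath : ∀ {u} → u ∈ S → Edge T (vertex P zero) u → ∃[ i ] vertex P i ≡ u
    onPath {u} u∈S e with ¬∀⟶∃¬ _ _ (λ i → ¬? (vertex P i ≟ u)) (λ fresh → stuck (u , u∈S , e , fresh))
    ... | i , ¬fresh = i , decidable-stable (vertex P i ≟ u) ¬fresh
    atMostOne : AtMostOneNeighbourIn T S (vertex P zero)
    atMostOne u∈S v∈S eu ev with onPath u∈S eu | onPath v∈S ev
    ... | i , refl | j , refl = onlyNeighbourOnPath acyclic P i j eu ev

  acyclic⇒leaf : ¬ Cycle T → Nonempty S → ∃[ x ] (x ∈ S × AtMostOneNeighbourIn T S x)
  acyclic⇒leaf acyclic (x , x∈S) =
    Sum.[ (λ P → contradiction (injective⇒≤ (injective P)) 1+n≰n) , (λ leaf → leaf) ]′ (pathOrLeaf n)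
    where
    pathOrLeaf : ∀ k → PathIn k ⊎ ∃[ x ] (x ∈ S × AtMostOneNeighbourIn T S x)
    pathOrLeaf zero = inj₁ (trivialPath x∈S)
    pathOrLeaf (suc k) with pathOrLeaf k
    ... | inj₂ leaf = inj₂ leaf
    ... | inj₁ P with growOrLeaf acyclic P
    ...   | inj₁ P′        = inj₁ P′
    ...   | inj₂ atMostOne = inj₂ (vertex P zero , inside P zero , atMostOne)

open Paths using (acyclic⇒leaf)

AtMostOneNeighbourIn-⊆ : ∀ {n} (T : Graph n) {S S′ x} → S′ ⊆ S →
                         AtMostOneNeighbourIn T S x → AtMostOneNeighbourIn T S′ x
AtMostOneNeighbourIn-⊆ _ S′⊆S atMostOne u∈S′ v∈S′ = atMostOne (S′⊆S u∈S′) (S′⊆S v∈S′)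

0<∣p∣⇒Nonempty : ∀ {n} (p : Subset n) → 0 < ∣ p ∣ → Nonempty p
0<∣p∣⇒Nonempty (true  ∷ p) _      = zero , here
0<∣p∣⇒Nonempty (false ∷ p) 0<∣p∣ = Product.map suc there (0<∣p∣⇒Nonempty p 0<∣p∣)

∣p∣<n⇒Nonempty∁p : ∀ {n} (p : Subset n) → ∣ p ∣ < n → Nonempty (∁ p)
∣p∣<n⇒Nonempty∁p p ∣p∣<n =
  0<∣p∣⇒Nonempty (∁ p) (subst (0 <_) (≡.sym (∣∁p∣≡n∸∣p∣ p)) (m<n⇒0<n∸m ∣p∣<n))

∣p∪⁅x⁆∣≡1+∣p∣ : ∀ {n} {p : Subset n} {x} → x ∉ p → ∣ p ∪ ⁅ x ⁆ ∣ ≡ suc ∣ p ∣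
∣p∪⁅x⁆∣≡1+∣p∣ {p = false ∷ p} {zero}  _   = cong (suc ∘ ∣_∣) (∪-identityʳ p)
∣p∪⁅x⁆∣≡1+∣p∣ {p = true  ∷ p} {zero}  x∉p = contradiction here x∉p
∣p∪⁅x⁆∣≡1+∣p∣ {p = true  ∷ p} {suc x} x∉p = cong suc (∣p∪⁅x⁆∣≡1+∣p∣ (x∉p ∘ there))
∣p∪⁅x⁆∣≡1+∣p∣ {p = false ∷ p} {suc x} x∉p = ∣p∪⁅x⁆∣≡1+∣p∣ (x∉p ∘ there)

acyclic⇒pendantSet : ∀ {n} (T : Graph n) → ¬ Cycle T →
                     ∀ j → j ≤ n → ∃[ W ] (∣ W ∣ ≡ j × AtMostOneNeighbourOutside T W)
acyclic⇒pendantSet {n} T acyclic zero _ = Subset.⊥ , ∣⊥∣≡0 n , λ w∈⊥ → contradiction w∈⊥ ∉⊥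
acyclic⇒pendantSet T acyclic (suc j) j<n with acyclic⇒pendantSet T acyclic j (<⇒≤ j<n)
... | W , refl , pendant with acyclic⇒leaf T (∁ W) acyclic (∣p∣<n⇒Nonempty∁p W j<n)
... | x , x∈∁W , leaf = W ∪ ⁅ x ⁆ , ∣p∪⁅x⁆∣≡1+∣p∣ (x∈∁p⇒x∉p x∈∁W) , pendant′
  where
  shrink : ∁ (W ∪ ⁅ x ⁆) ⊆ ∁ W
  shrink y∈∁W′ = x∉p⇒x∈∁p (x∈∁p⇒x∉p y∈∁W′ ∘ p⊆p∪q ⁅ x ⁆)
  pendant′ : AtMostOneNeighbourOutside T (W ∪ ⁅ x ⁆)
  pendant′ w∈W′ with x∈p∪q⁻ W ⁅ x ⁆ w∈W′
  ... | inj₁ w∈W = AtMostOneNeighbourIn-⊆ T shrink (pendant w∈W)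
  ... | inj₂ w∈⁅x⁆ with x∈⁅y⁆⇒x≡y x w∈⁅x⁆
  ... | refl = AtMostOneNeighbourIn-⊆ T shrink leaf

¬¬-least : ∀ {P : ℕ → Set} k → P k → ¬ ¬ (∃[ b ] (P b × ∀ j → P j → b ≤ j))
¬¬-least {P} = <-rec _ step
  where
  step : ∀ k → (∀ {j} → j < k → P j → ¬ ¬ (∃[ b ] (P b × ∀ j → P j → b ≤ j))) →
         P k → ¬ ¬ (∃[ b ] (P b × ∀ j → P j → b ≤ j))
  step k smaller Pk no-least = no-least (k , Pk , λ j Pj → ≮⇒≥ (λ j<k → smaller j<k Pj no-least))

Resolving⇒¬¬IsMetricDim : ∀ {n} (H : Graph n) W → Resolving H W → ¬ ¬ (∃[ b ] (IsMetricDim H b × b ≤ ∣ W ∣))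
Resolving⇒¬¬IsMetricDim H W resolves no-dim = ¬¬-least ∣ W ∣ (W , resolves , refl) λ (b , witness , least) →
  no-dim (b , (witness , λ V rV → least ∣ V ∣ (V , rV , refl)) , least ∣ W ∣ (W , resolves , refl))

-- β(H) exists only classically, which suffices as t ≤ d is decidable.
forest-threshold≤ : ∀ {n} (T : Graph n) → ¬ Cycle T → ∀ {t} → IsThresholdDim T t →
                    ∀ d → d < n → n ≤ 2 ^ d + d → t ≤ d
forest-threshold≤ T acyclic {t} (_ , least) d d<n n≤2^d+d
  with acyclic⇒pendantSet T acyclic d (<⇒≤ d<n)
... | W , refl , pendant
  with resolvedSupergraph T W pendant (Equivalence.from (∣∁p∣≤m⇔n≤m+∣p∣ W _) n≤2^d+d)
                          (∣p∣<n⇒Nonempty∁p W d<n)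
... | H , super , resolves = decidable-stable (t ≤? ∣ W ∣) λ t≰∣W∣ →
  Resolving⇒¬¬IsMetricDim H W resolves λ (b , dim , b≤∣W∣) →
  t≰∣W∣ (≤-trans (least H b super dim) b≤∣W∣)

-- The star

star-edge : ∀ {m} {x y : Fin (suc m)} → Edge (star m) x y → x ≡ zero ⊎ y ≡ zero
star-edge {x = zero}              _ = inj₁ refl
star-edge {x = suc _} {y = zero}  _ = inj₂ refl

star-connected : ∀ m → Connected (star m)
star-connected m zero    zero    = 0 , nil
star-connected m zero    (suc _) = 1 , cons refl nil
star-connected m (suc _) zero    = 1 , cons refl nil
star-connected m (suc _) (suc _) = 2 , cons {v = zero} refl (cons refl nil)

star-acyclic : ∀ m → ¬ Cycle (star m)
star-acyclic m (k , f , f-injective , steps , closing) =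
  centre-twice (star-edge (steps zero)) (star-edge (steps (suc zero))) (star-edge closing)
  where
  clash : ∀ {a b} → f a ≡ zero → f b ≡ zero → a ≢ b → ⊥
  clash fa≡0 fb≡0 a≢b = a≢b (f-injective (trans fa≡0 (≡.sym fb≡0)))
  centre-twice : f zero ≡ zero ⊎ f (suc zero) ≡ zero → f (suc zero) ≡ zero ⊎ f (suc (suc zero)) ≡ zero →
                 f (fromℕ (suc (suc k))) ≡ zero ⊎ f zero ≡ zero → ⊥
  centre-twice (inj₁ f₀≡0) (inj₁ f₁≡0) _           = clash f₀≡0 f₁≡0 λ ()
  centre-twice (inj₁ f₀≡0) (inj₂ f₂≡0) _           = clash f₀≡0 f₂≡0 λ ()
  centre-twice (inj₂ f₁≡0) (inj₂ f₂≡0) _           = clash f₁≡0 f₂≡0 λ ()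
  centre-twice (inj₂ f₁≡0) (inj₁ _)    (inj₁ fₗ≡0) = clash f₁≡0 fₗ≡0 λ ()
  centre-twice (inj₂ f₁≡0) (inj₁ _)    (inj₂ f₀≡0) = clash f₁≡0 f₀≡0 λ ()

star-isTree : ∀ m → IsTree (star m)
star-isTree m = star-connected m , star-acyclic m

SpanningSuper-star⇒Universal : ∀ {m} (H : Graph (suc m)) → SpanningSuper (star m) H → Universal H zero
SpanningSuper-star⇒Universal H super zero    0≢0 = contradiction refl 0≢0
SpanningSuper-star⇒Universal H super (suc x) _   = super zero (suc x) refl

IsG-least : ∀ {n d} → IsG n d → ∀ e → n ≤ 2 ^ e + e → d ≤ e
IsG-least (_ , below) e n≤2^e+e = ≮⇒≥ (λ e<d → below e e<d n≤2^e+e)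

IsG⇒d<n : ∀ {m d} → IsG (suc m) d → d < suc m
IsG⇒d<n {m} g = s≤s (IsG-least g m (+-monoˡ-≤ m (m^n>0 2 m)))

star-resolving≥ : ∀ {m d} → IsG (suc m) d →
                  ∀ H → SpanningSuper (star m) H → ∀ V → Resolving H V → d ≤ ∣ V ∣
star-resolving≥ g H super V resolves = IsG-least g ∣ V ∣
  (Equivalence.to (∣∁p∣≤m⇔n≤m+∣p∣ V _)
    (Universal-Resolving⇒∣∁W∣≤2^∣W∣ H (SpanningSuper-star⇒Universal H super) V resolves))

star-threshold : ∀ {m d} → IsG (suc m) d → IsThresholdDim (star m) d
star-threshold {m} {d} g with acyclic⇒pendantSet (star m) (star-acyclic m) d (<⇒≤ (IsG⇒d<n g))
... | W , refl , pendant
  with resolvedSupergraph (star m) W pendant (Equivalence.from (∣∁p∣≤m⇔n≤m+∣p∣ W _) (proj₁ g))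
         (∣p∣<n⇒Nonempty∁p W (IsG⇒d<n g))
... | H , super , resolves =
  (H , super , (W , resolves , refl) , star-resolving≥ g H super) ,
  λ { H′ b super′ ((W′ , resolves′ , refl) , _) → star-resolving≥ g H′ super′ W′ resolves′ }

theorem13 : (∀ (m : ℕ) (T : Graph (suc m)) (t d : ℕ) →
                IsTree T → IsThresholdDim T t → IsG (suc m) d → t ≤ d)
            × (∀ (m d : ℕ) → IsG (suc m) d →
                IsTree (star m) × IsThresholdDim (star m) d)
theorem13 =
  (λ m T t d (_ , acyclic) threshold g → forest-threshold≤ T acyclic threshold d (IsG⇒d<n g) (proj₁ g)) ,
  (λ m d g → star-isTree m , star-threshold g)
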